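{- Let $G$ be a finite, simple, connected $(n,k,\lambda,\mu)$-strongly regular graph that is neither complete nor complete bipartite. For an edge $uv$ of $G$, let $E_{uv}\in\mathcal{K}(G)$ denote the class of $\mathbf{e}_u-\mathbf{e}_v$. Then for every edge $uv$, $\langle E_{uv},E_{uv}\rangle=\frac{2(n-1)}{kn}\neq0$ in $\mathbb{Q}/\mathbb{Z}$. Moreover, if $xy$ is another edge sharing no vertex with $uv$ and such that either $N(x)\cap\{u,v\}=N(y)\cap\{u,v\}$, or $u,v\in N(x)$ and $u,v\notin N(y)$, or $u,v\notin N(x)$ and $u,v\in N(y)$, then $\langle E_{uv},E_{xy}\rangle=0$ in $\mathbb{Q}/\mathbb{Z}$.
   Context: An $(n,k,\lambda,\mu)$-strongly regular graph is a $k$-regular graph on $n$ vertices in which any two adjacent vertices have exactly $\lambda$ common neighbors and any two non-adjacent vertices have exactly $\mu$ common neighbors. $N(x)$ is the neighborhood of $x$; $\mathbf{e}_1,\dots,\mathbf{e}_n$ is the standard basis of $\mathbb{Z}^n$. The Laplacian is $L=D-A$ and the critical group is $\mathcal{K}(G)=\{\mathbf{u}\in\mathbb{Z}^n:\sum_i\mathbf{u}_i=0\}/\operatorname{row}_{\mathbb{Z}}L$. The monodromy pairing $\langle\cdot,\cdot\rangle:\mathcal{K}(G)\times\mathcal{K}(G)\to\mathbb{Q}/\mathbb{Z}$ is defined as follows: for $\mathbf{D},\mathbf{D}'$ with coordinate sum $0$, choose positive integers $m,m'$ and $\mathbf{f},\mathbf{f}'\in\mathbb{Z}^n$ with $L\mathbf{f}=m\mathbf{D}$,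 $L\mathbf{f}'=m'\mathbf{D}'$; then $\langle[\mathbf{D}],[\mathbf{D}']\rangle=\frac{\mathbf{f}^T\mathbf{D}'}{m}=\frac{\mathbf{D}^T\mathbf{f}'}{m'}\bmod\mathbb{Z}$ (this is well defined, bilinear and symmetric). -}

module Defs where

open import Data.Nat as ℕ using (ℕ; zero; suc)
open import Data.Integer as ℤ using (ℤ; +_)
open import Data.Rational as ℚ using (ℚ; 0ℚ)
open import Data.Fin using (Fin; zero; suc)
open import Data.Bool using (Bool; true; false; _∧_)
open import Data.Product using (Σ; ∃; ∃-syntax; _×_; _,_)
open import Relation.Binary.PropositionalEquality using (_≡_; _≢_)
open import Relation.Nullary using (¬_; yes; no)
open import Function.Bundles using (_⇔_)
import Data.Fin.Properties as FinP

sumℕ : ∀ {n} → (Fin n → ℕ) → ℕ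
sumℕ {zero} f = 0
sumℕ {suc n} f = f zero ℕ.+ sumℕ (λ i → f (suc i))

sumℤ : ∀ {n} → (Fin n → ℤ) → ℤ
sumℤ {zero} f = + 0
sumℤ {suc n} f = f zero ℤ.+ sumℤ (λ i → f (suc i))

toℕ𝔹 : Bool → ℕ
toℕ𝔹 true = 1
toℕ𝔹 false = 0

record Graph (n : ℕ) : Set where
  field
    adj     : Fin n → Fin n → Bool
    symm    : ∀ x y → adj x y ≡ adj y x
    irrefl  : ∀ x → adj x x ≡ false
open Graph public

deg : ∀ {n} → Graph n → Fin n → ℕ
deg G x = sumℕ (λ y → toℕ𝔹 (adj G x y))

commonNbrs : ∀ {n} → Graph n → Fin n → Fin n → ℕ
commonNbrs G x y = sumℕ (λ z → toℕ𝔹 (adj G x z ∧ adj G y z))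

IsSRG : ∀ {n} → Graph n → (k l m : ℕ) → Set
IsSRG G k l m =
  (∀ x → deg G x ≡ k) ×
  (∀ x y → x ≢ y → adj G x y ≡ true → commonNbrs G x y ≡ l) ×
  (∀ x y → x ≢ y → adj G x y ≡ false → commonNbrs G x y ≡ m)

data Reach {n} (G : Graph n) : Fin n → Fin n → Set where
  here : ∀ {x} → Reach G x x
  step : ∀ {x y z} → adj G x y ≡ true → Reach G y z → Reach G x z

Connected : ∀ {n} → Graph n → Set
Connected G = ∀ x y → Reach G x y

Complete : ∀ {n} → Graph n → Set
Complete G = ∀ x y → x ≢ y → adj G x y ≡ true

CompleteBipartite : ∀ {n} → Graph n → Set
CompleteBipartite {n} G =
  Σ (Fin n → Bool) λ S →
    (∃[ a ] S a ≡ true) × (∃[ b ] S b ≡ false) ×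
    (∀ x y → (adj G x y ≡ true) ⇔ (S x ≢ S y))

laplacian : ∀ {n} → Graph n → (Fin n → ℤ) → (Fin n → ℤ)
laplacian G f x =
  (+ deg G x) ℤ.* f x ℤ.- sumℤ (λ y → (+ toℕ𝔹 (adj G x y)) ℤ.* f y)

dot : ∀ {n} → (Fin n → ℤ) → (Fin n → ℤ) → ℤ
dot f g = sumℤ (λ i → f i ℤ.* g i)

eDiff : ∀ {n} → Fin n → Fin n → (Fin n → ℤ)
eDiff u v w =
  (case? w u) ℤ.- (case? w v)
  where
    case? : ∀ {n} → Fin n → Fin n → ℤ
    case? a b with a FinP.≟ b
    ... | yes _ = + 1
    ... | no  _ = + 0

-- total division ℤ → ℕ → ℚ (only ever used with positive denominator)
_/?_ : ℤ → ℕ → ℚ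
z /? zero = 0ℚ
z /? suc d = z ℚ./ suc d

IsInt : ℚ → Set
IsInt q = ∃[ z ] q ≡ (z ℚ./ 1)

_≡ℚ/ℤ_ : ℚ → ℚ → Set
p ≡ℚ/ℤ q = IsInt (p ℚ.- q)

-- ⟨[D],[D']⟩ = q in ℚ/ℤ (for D, D' of coordinate sum 0): a choice of
-- m > 0, f with L f = m D exists, and every such choice gives f^T D' / m ≡ q.
PairingIs : ∀ {n} → Graph n → (D D' : Fin n → ℤ) → ℚ → Set
PairingIs {n} G D D' q =
  (∃[ m ] ∃[ f ] (0 ℕ.< m × (∀ x → laplacian G f x ≡ (+ m) ℤ.* D x))) ×
  (∀ (m : ℕ) (f : Fin n → ℤ) → 0 ℕ.< m →
     (∀ x → laplacian G f x ≡ (+ m) ℤ.* D x) →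
     (dot f D' /? m) ≡ℚ/ℤ q)

-- In a strongly regular graph A² = (k − μ)I + (λ − μ)A + μJ, and the parameters satisfy
-- k(k − λ − 1) = μ(n − k − 1). Hence on integer vectors D of coordinate sum 0 the operator
-- cI + A with c = k − λ + μ inverts the Laplacian up to the scalar μn: L(cD + AD) = μn D.
-- With this explicit preimage ⟨D, D'⟩ = Dᵀ(cD' + AD')/(μn). For D = D' = e_u − e_v this is
-- 2(c − 1)/(μn) = 2(n − 1)/(kn); for a second edge xy away from u, v it is
-- ((A_ux − A_uy) − (A_vx − A_vy))/(μn), which the adjacency conditions make 0.
-- Connectivity gives μ ≠ 0, and k = 1 would force G = K₂, so 0 < 2(n − 1) < kn.
module Submission where

open import Defs
open import Data.Nat as ℕ using (ℕ; zero; suc; z≤n; s≤s)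
import Data.Nat.Properties as ℕₚ
import Data.Nat.Divisibility as ℕ
open import Data.Integer using (ℤ; +_; _+_; _-_; _*_; -_; ∣_∣; 0ℤ; 1ℤ; -1ℤ)
import Data.Integer.Properties as ℤₚ
open import Data.Integer.Tactic.RingSolver using (solve-∀)
open import Data.Rational using (0ℚ)
import Data.Rational.Properties as ℚₚ
import Data.Rational.Unnormalised as ℚᵘ
open import Data.Fin using (Fin; zero; suc; punchIn)
import Data.Fin.Properties as Finₚ
open import Data.Bool using (Bool; true; false; _∧_)
import Data.Bool.Properties as Boolₚ
open import Data.Product using (_×_; _,_; proj₁; proj₂)
open import Data.Sum using (_⊎_; inj₁; inj₂; [_,_]′)
open import Function using (_∘_; id)
open import Relation.Binary.PropositionalEquality
open import Relation.Nullary using (¬_; yes; no; contradiction)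
open import Algebra.Properties.Semiring.Sum ℤₚ.+-*-semiring
  using (sum; sum-cong-≗; sum-remove; sum-replicate-zero; ∑-distrib-+; ∑-comm; *-distribˡ-sum; *-distribʳ-sum)

open ≡-Reasoning

sumℤ≗sum : ∀ {n} (f : Fin n → ℤ) → sumℤ f ≡ sum f
sumℤ≗sum {zero}  f = refl
sumℤ≗sum {suc n} f = cong (_+_ (f zero)) (sumℤ≗sum (f ∘ suc))

pos-sumℕ : ∀ {n} (f : Fin n → ℕ) → + sumℕ f ≡ sum (λ i → + f i)
pos-sumℕ {zero}  f = refl
pos-sumℕ {suc n} f = trans (ℤₚ.pos-+ (f zero) _) (cong (_+_ (+ f zero)) (pos-sumℕ (f ∘ suc)))

sumℕ-cong : ∀ {n} {f g : Fin n → ℕ} → (∀ i → f i ≡ g i) → sumℕ f ≡ sumℕ g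
sumℕ-cong {zero}  f≗g = refl
sumℕ-cong {suc n} f≗g = cong₂ ℕ._+_ (f≗g zero) (sumℕ-cong (f≗g ∘ suc))

sumℕ-≥ : ∀ {n} (f : Fin n → ℕ) i → f i ℕ.≤ sumℕ f
sumℕ-≥ f zero    = ℕₚ.m≤m+n (f zero) _
sumℕ-≥ f (suc i) = ℕₚ.≤-trans (sumℕ-≥ (f ∘ suc) i) (ℕₚ.m≤n+m _ (f zero))

sum-const-1 : ∀ n → sum {n} (λ _ → 1ℤ) ≡ + n
sum-const-1 zero    = refl
sum-const-1 (suc n) = cong (_+_ 1ℤ) (sum-const-1 n)

*-distribˡ-minus : ∀ a b c → a * (b - c) ≡ a * b - a * c
*-distribˡ-minus = solve-∀

∑-distrib-minus : ∀ {n} (f g : Fin n → ℤ) → sum (λ i → f i - g i) ≡ sum f - sum g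
∑-distrib-minus f g = begin
  sum (λ i → f i - g i)     ≡⟨ ∑-distrib-+ f (-_ ∘ g) ⟩
  sum f + sum (-_ ∘ g)      ≡⟨ cong (_+_ (sum f)) (sum-cong-≗ (sym ∘ ℤₚ.-1*i≡-i ∘ g)) ⟩
  sum f + sum ((-1ℤ *_) ∘ g) ≡⟨ cong (_+_ (sum f)) (sym (*-distribˡ-sum -1ℤ g)) ⟩
  sum f + -1ℤ * sum g       ≡⟨ cong (_+_ (sum f)) (ℤₚ.-1*i≡-i (sum g)) ⟩
  sum f - sum g             ∎

sum-vanishing-off : ∀ {n} (f : Fin n → ℤ) i → (∀ j → j ≢ i → f j ≡ 0ℤ) → sum f ≡ f i
sum-vanishing-off {suc n} f i f≡0 = begin
  sum f                      ≡⟨ sum-remove {i = i} f ⟩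
  f i + sum (f ∘ punchIn i)  ≡⟨ cong (_+_ (f i)) (sum-cong-≗ (λ j → f≡0 (punchIn i j) (Finₚ.punchInᵢ≢i i j))) ⟩
  f i + sum {n} (λ _ → 0ℤ)   ≡⟨ cong (_+_ (f i)) (sum-replicate-zero n) ⟩
  f i + 0ℤ                   ≡⟨ ℤₚ.+-identityʳ (f i) ⟩
  f i                        ∎

δ : ∀ {n} → Fin n → Fin n → ℤ
δ i j with i Finₚ.≟ j
... | yes _ = 1ℤ
... | no  _ = 0ℤ

δ-refl : ∀ {n} (i : Fin n) → δ i i ≡ 1ℤ
δ-refl i with i Finₚ.≟ i
... | yes _   = refl
... | no  i≢i = contradiction refl i≢i

δ-≢ : ∀ {n} {i j : Fin n} → i ≢ j → δ i j ≡ 0ℤ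
δ-≢ {i = i} {j} i≢j with i Finₚ.≟ j
... | yes i≡j = contradiction i≡j i≢j
... | no  _   = refl

∑-*δ : ∀ {n} (f : Fin n → ℤ) i → sum (λ j → f j * δ j i) ≡ f i
∑-*δ f i = begin
  sum (λ j → f j * δ j i)  ≡⟨ sum-vanishing-off _ i (λ j j≢i → trans (cong (f j *_) (δ-≢ j≢i)) (ℤₚ.*-zeroʳ (f j))) ⟩
  f i * δ i i              ≡⟨ cong (f i *_) (δ-refl i) ⟩
  f i * 1ℤ                 ≡⟨ ℤₚ.*-identityʳ (f i) ⟩
  f i                      ∎

eDiff≡δ-δ : ∀ {n} (u v w : Fin n) → eDiff u v w ≡ δ w u - δ w v
eDiff≡δ-δ u v w with w Finₚ.≟ u | w Finₚ.≟ v
... | yes _ | yes _ = refl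
... | yes _ | no  _ = refl
... | no  _ | yes _ = refl
... | no  _ | no  _ = refl

∑-*eDiff : ∀ {n} (f : Fin n → ℤ) u v → sum (λ w → f w * eDiff u v w) ≡ f u - f v
∑-*eDiff f u v = begin
  sum (λ w → f w * eDiff u v w)                ≡⟨ sum-cong-≗ distribute ⟩
  sum (λ w → f w * δ w u - f w * δ w v)        ≡⟨ ∑-distrib-minus (λ w → f w * δ w u) (λ w → f w * δ w v) ⟩
  sum (λ w → f w * δ w u) - sum (λ w → f w * δ w v)  ≡⟨ cong₂ _-_ (∑-*δ f u) (∑-*δ f v) ⟩
  f u - f v                                    ∎
  where
  distribute : ∀ w → f w * eDiff u v w ≡ f w * δ w u - f w * δ w v
  distribute w = trans (cong (f w *_) (eDiff≡δ-δ u v w)) (*-distribˡ-minus (f w) (δ w u) (δ w v))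

dot≡∑ : ∀ {n} (f g : Fin n → ℤ) → dot f g ≡ sum (λ i → f i * g i)
dot≡∑ f g = sumℤ≗sum (λ i → f i * g i)

dot-comm : ∀ {n} (f g : Fin n → ℤ) → dot f g ≡ dot g f
dot-comm f g = begin
  dot f g                  ≡⟨ dot≡∑ f g ⟩
  sum (λ i → f i * g i)    ≡⟨ sum-cong-≗ (λ i → ℤₚ.*-comm (f i) (g i)) ⟩
  sum (λ i → g i * f i)    ≡⟨ dot≡∑ g f ⟨
  dot g f                  ∎

dot-congˡ : ∀ {n} {f f' : Fin n → ℤ} (g : Fin n → ℤ) → (∀ i → f i ≡ f' i) → dot f g ≡ dot f' g
dot-congˡ {f = f} {f'} g f≗f' = begin
  dot f g                  ≡⟨ dot≡∑ f g ⟩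
  sum (λ i → f i * g i)    ≡⟨ sum-cong-≗ (λ i → cong (_* g i) (f≗f' i)) ⟩
  sum (λ i → f' i * g i)   ≡⟨ dot≡∑ f' g ⟨
  dot f' g                 ∎

dot-*ˡ : ∀ {n} c (f g : Fin n → ℤ) → dot (λ i → c * f i) g ≡ c * dot f g
dot-*ˡ c f g = begin
  dot (λ i → c * f i) g        ≡⟨ dot≡∑ (λ i → c * f i) g ⟩
  sum (λ i → c * f i * g i)    ≡⟨ sum-cong-≗ (λ i → ℤₚ.*-assoc c (f i) (g i)) ⟩
  sum (λ i → c * (f i * g i))  ≡⟨ *-distribˡ-sum c (λ i → f i * g i) ⟨
  c * sum (λ i → f i * g i)    ≡⟨ cong (c *_) (dot≡∑ f g) ⟨
  c * dot f g                  ∎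

dot-eDiffˡ : ∀ {n} (u v : Fin n) (g : Fin n → ℤ) → dot (eDiff u v) g ≡ g u - g v
dot-eDiffˡ u v g = begin
  dot (eDiff u v) g              ≡⟨ dot-comm (eDiff u v) g ⟩
  dot g (eDiff u v)              ≡⟨ dot≡∑ g (eDiff u v) ⟩
  sum (λ w → g w * eDiff u v w)  ≡⟨ ∑-*eDiff g u v ⟩
  g u - g v                      ∎

sum-eDiff : ∀ {n} (u v : Fin n) → sum (eDiff u v) ≡ 0ℤ
sum-eDiff u v = begin
  sum (eDiff u v)                 ≡⟨ sum-cong-≗ (λ w → sym (ℤₚ.*-identityˡ (eDiff u v w))) ⟩
  sum (λ w → 1ℤ * eDiff u v w)    ≡⟨ ∑-*eDiff (λ _ → 1ℤ) u v ⟩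
  1ℤ - 1ℤ                         ∎

/?-cong : ∀ {p r : ℤ} {b d : ℕ} → 0 ℕ.< b → 0 ℕ.< d → p * + d ≡ r * + b → p /? b ≡ r /? d
/?-cong {p} {r} {suc b} {suc d} _ _ p*d≡r*b =
  ℚₚ.fromℚᵘ-cong {ℚᵘ.mkℚᵘ p b} {ℚᵘ.mkℚᵘ r d} (ℚᵘ.*≡* p*d≡r*b)

0/?≡0 : ∀ {m} → 0 ℕ.< m → 0ℤ /? m ≡ 0ℚ
0/?≡0 {suc m} _ = ℚₚ.0/n≡0 (suc m)

≡⇒≡ℚ/ℤ : ∀ {p q} → p ≡ q → p ≡ℚ/ℤ q
≡⇒≡ℚ/ℤ {p} refl = 0ℤ , ℚₚ.+-inverseʳ p

-- a/b ≡ z/1 would make the positive a a multiple of b > a.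
¬IsInt-/? : ∀ {a b} → 0 ℕ.< a → a ℕ.< b → ¬ IsInt ((+ a) /? b)
¬IsInt-/? {suc a} {suc b} _ a<b (z , a/b≡z) with ℚₚ.fromℚᵘ-injective {ℚᵘ.mkℚᵘ (+ suc a) b} {ℚᵘ.mkℚᵘ z 0} a/b≡z
... | ℚᵘ.*≡* a*1≡z*b = ℕₚ.<⇒≱ a<b (ℕ.∣⇒≤ (ℕ.divides ∣ z ∣ a≡∣z∣*b))
  where
  a≡∣z∣*b : suc a ≡ ∣ z ∣ ℕ.* suc b
  a≡∣z∣*b = trans (cong ∣_∣ (trans (sym (ℤₚ.*-identityʳ (+ suc a))) a*1≡z*b)) (ℤₚ.abs-* z (+ suc b))

toℕ𝔹-∧ : ∀ a b → + toℕ𝔹 (a ∧ b) ≡ + toℕ𝔹 a * + toℕ𝔹 b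
toℕ𝔹-∧ true  b = sym (ℤₚ.*-identityˡ (+ toℕ𝔹 b))
toℕ𝔹-∧ false b = refl

sameDifference : ∀ {a b c d : Bool} →
  (a ≡ c × b ≡ d) ⊎ (a ≡ true × b ≡ true × c ≡ false × d ≡ false)
                  ⊎ (a ≡ false × b ≡ false × c ≡ true × d ≡ true) →
  + toℕ𝔹 a - + toℕ𝔹 c ≡ + toℕ𝔹 b - + toℕ𝔹 d
sameDifference {a} {b} (inj₁ (refl , refl)) =
  trans (ℤₚ.+-inverseʳ (+ toℕ𝔹 a)) (sym (ℤₚ.+-inverseʳ (+ toℕ𝔹 b)))
sameDifference (inj₂ (inj₁ (refl , refl , refl , refl))) = refl
sameDifference (inj₂ (inj₂ (refl , refl , refl , refl))) = refl

distinct⇒2≤n : ∀ {n} {u v : Fin n} → u ≢ v → 2 ℕ.≤ n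
distinct⇒2≤n {suc zero}    {zero} {zero} u≢v = contradiction refl u≢v
distinct⇒2≤n {suc (suc n)} _                 = s≤s (s≤s z≤n)

module Adjacency {n} (G : Graph n) where

  A : Fin n → Fin n → ℤ
  A x y = + toℕ𝔹 (adj G x y)

  A-sym : ∀ x y → A x y ≡ A y x
  A-sym x y = cong (+_ ∘ toℕ𝔹) (symm G x y)

  A-diag : ∀ x → A x x ≡ 0ℤ
  A-diag x = cong (+_ ∘ toℕ𝔹) (irrefl G x)

  A-edge : ∀ {x y} → adj G x y ≡ true → A x y ≡ 1ℤ
  A-edge xy = cong (+_ ∘ toℕ𝔹) xy

  edge⇒≢ : ∀ {x y} → adj G x y ≡ true → x ≢ y
  edge⇒≢ {x} xy refl with trans (sym xy) (irrefl G x)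
  ... | ()

  edge⇒1≤deg : ∀ {x y} → adj G x y ≡ true → 1 ℕ.≤ deg G x
  edge⇒1≤deg {x} {y} xy = subst (ℕ._≤ deg G x) (cong toℕ𝔹 xy) (sumℕ-≥ (toℕ𝔹 ∘ adj G x) y)

  commonNbr⇒1≤commonNbrs : ∀ {x y z} → adj G x z ≡ true → adj G y z ≡ true → 1 ℕ.≤ commonNbrs G x y
  commonNbr⇒1≤commonNbrs {x} {y} {z} xz yz =
    subst (ℕ._≤ commonNbrs G x y) (cong₂ (λ a b → toℕ𝔹 (a ∧ b)) xz yz)
          (sumℕ-≥ (λ w → toℕ𝔹 (adj G x w ∧ adj G y w)) z)

  commonNbrs-diag : ∀ x → commonNbrs G x x ≡ deg G x
  commonNbrs-diag x = sumℕ-cong (λ z → cong toℕ𝔹 (Boolₚ.∧-idem (adj G x z)))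

  A· : (Fin n → ℤ) → Fin n → ℤ
  A· f x = sum (λ y → A x y * f y)

  A·-const1 : ∀ x → A· (λ _ → 1ℤ) x ≡ + deg G x
  A·-const1 x = begin
    sum (λ y → A x y * 1ℤ)  ≡⟨ sum-cong-≗ (ℤₚ.*-identityʳ ∘ A x) ⟩
    sum (A x)               ≡⟨ pos-sumℕ (toℕ𝔹 ∘ adj G x) ⟨
    + deg G x               ∎

  A·-linear : ∀ c f g x → A· (λ y → c * f y + g y) x ≡ c * A· f x + A· g x
  A·-linear c f g x = begin
    sum (λ y → A x y * (c * f y + g y))                    ≡⟨ sum-cong-≗ distribute ⟩
    sum (λ y → c * (A x y * f y) + A x y * g y)            ≡⟨ ∑-distrib-+ (λ y → c * (A x y * f y)) (λ y → A x y * g y) ⟩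
    sum (λ y → c * (A x y * f y)) + A· g x                 ≡⟨ cong (_+ A· g x) (*-distribˡ-sum c (λ y → A x y * f y)) ⟨
    c * A· f x + A· g x                                    ∎
    where
    distribute : ∀ y → A x y * (c * f y + g y) ≡ c * (A x y * f y) + A x y * g y
    distribute y = rearrange (A x y) c (f y) (g y)
      where
      rearrange : ∀ a c b d → a * (c * b + d) ≡ c * (a * b) + a * d
      rearrange = solve-∀

  laplacian≡ : ∀ f x → laplacian G f x ≡ + deg G x * f x - A· f x
  laplacian≡ f x = cong (_-_ (+ deg G x * f x)) (sumℤ≗sum (λ y → A x y * f y))

  commonNbrs≡∑ : ∀ x y → + commonNbrs G x y ≡ sum (λ z → A x z * A z y)
  commonNbrs≡∑ x y = begin
    + commonNbrs G x y                                ≡⟨ pos-sumℕ (λ z → toℕ𝔹 (adj G x z ∧ adj G y z)) ⟩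
    sum (λ z → + toℕ𝔹 (adj G x z ∧ adj G y z))        ≡⟨ sum-cong-≗ (λ z → toℕ𝔹-∧ (adj G x z) (adj G y z)) ⟩
    sum (λ z → A x z * A y z)                         ≡⟨ sum-cong-≗ (λ z → cong (A x z *_) (A-sym y z)) ⟩
    sum (λ z → A x z * A z y)                         ∎

  A·A·≡∑commonNbrs : ∀ f x → A· (A· f) x ≡ sum (λ y → + commonNbrs G x y * f y)
  A·A·≡∑commonNbrs f x = begin
    sum (λ z → A x z * sum (λ y → A z y * f y))
      ≡⟨ sum-cong-≗ (λ z → *-distribˡ-sum (A x z) (λ y → A z y * f y)) ⟩
    sum (λ z → sum (λ y → A x z * (A z y * f y)))
      ≡⟨ ∑-comm (λ z y → A x z * (A z y * f y)) ⟩
    sum (λ y → sum (λ z → A x z * (A z y * f y)))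
      ≡⟨ sum-cong-≗ (λ y → sum-cong-≗ (λ z → sym (ℤₚ.*-assoc (A x z) (A z y) (f y)))) ⟩
    sum (λ y → sum (λ z → A x z * A z y * f y))
      ≡⟨ sum-cong-≗ (λ y → *-distribʳ-sum (f y) (λ z → A x z * A z y)) ⟨
    sum (λ y → sum (λ z → A x z * A z y) * f y)
      ≡⟨ sum-cong-≗ (λ y → cong (_* f y) (commonNbrs≡∑ x y)) ⟨
    sum (λ y → + commonNbrs G x y * f y)
      ∎

  A·-selfAdjoint : ∀ f g → sum (λ x → A· f x * g x) ≡ sum (λ x → A· g x * f x)
  A·-selfAdjoint f g = begin
    sum (λ x → sum (λ y → A x y * f y) * g x)         ≡⟨ sum-cong-≗ (λ x → *-distribʳ-sum (g x) (λ y → A x y * f y)) ⟩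
    sum (λ x → sum (λ y → A x y * f y * g x))         ≡⟨ ∑-comm (λ x y → A x y * f y * g x) ⟩
    sum (λ y → sum (λ x → A x y * f y * g x))         ≡⟨ sum-cong-≗ (λ y → sum-cong-≗ (λ x → swap y x)) ⟩
    sum (λ y → sum (λ x → A y x * g x * f y))         ≡⟨ sum-cong-≗ (λ y → *-distribʳ-sum (f y) (λ x → A y x * g x)) ⟨
    sum (λ y → sum (λ x → A y x * g x) * f y)         ∎
    where
    swap : ∀ y x → A x y * f y * g x ≡ A y x * g x * f y
    swap y x = trans (cong (λ a → a * f y * g x) (A-sym x y)) (rearrange (A y x) (f y) (g x))
      where
      rearrange : ∀ a b c → a * b * c ≡ a * c * b
      rearrange = solve-∀

  dot-laplacian : ∀ f g →
    dot (laplacian G f) g ≡ sum (λ x → + deg G x * (f x * g x)) - sum (λ x → A· f x * g x)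
  dot-laplacian f g = begin
    dot (laplacian G f) g                                   ≡⟨ dot-congˡ g (laplacian≡ f) ⟩
    dot (λ x → + deg G x * f x - A· f x) g                  ≡⟨ dot≡∑ (λ x → + deg G x * f x - A· f x) g ⟩
    sum (λ x → (+ deg G x * f x - A· f x) * g x)            ≡⟨ sum-cong-≗ (λ x → distribute (+ deg G x) (f x) (A· f x) (g x)) ⟩
    sum (λ x → + deg G x * (f x * g x) - A· f x * g x)      ≡⟨ ∑-distrib-minus (λ x → + deg G x * (f x * g x)) (λ x → A· f x * g x) ⟩
    sum (λ x → + deg G x * (f x * g x)) - sum (λ x → A· f x * g x)  ∎
    where
    distribute : ∀ d a b c → (d * a - b) * c ≡ d * (a * c) - b * c
    distribute = solve-∀

  laplacian-selfAdjoint : ∀ f g → dot (laplacian G f) g ≡ dot f (laplacian G g)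
  laplacian-selfAdjoint f g = begin
    dot (laplacian G f) g
      ≡⟨ dot-laplacian f g ⟩
    sum (λ x → + deg G x * (f x * g x)) - sum (λ x → A· f x * g x)
      ≡⟨ cong₂ _-_ (sum-cong-≗ (λ x → cong (+ deg G x *_) (ℤₚ.*-comm (f x) (g x)))) (A·-selfAdjoint f g) ⟩
    sum (λ x → + deg G x * (g x * f x)) - sum (λ x → A· g x * f x)
      ≡⟨ dot-laplacian g f ⟨
    dot (laplacian G g) f
      ≡⟨ dot-comm (laplacian G g) f ⟩
    dot f (laplacian G g)
      ∎

  pairing-via-preimage : ∀ {m M : ℕ} {f P D D' : Fin n → ℤ} →
    (∀ x → laplacian G f x ≡ + m * D x) → (∀ x → laplacian G P x ≡ + M * D' x) →
    + M * dot f D' ≡ + m * dot D P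
  pairing-via-preimage {m} {M} {f} {P} {D} {D'} Lf≡mD LP≡MD' = begin
    + M * dot f D'                ≡⟨ cong (+ M *_) (dot-comm f D') ⟩
    + M * dot D' f                ≡⟨ dot-*ˡ (+ M) D' f ⟨
    dot (λ x → + M * D' x) f      ≡⟨ dot-congˡ f (sym ∘ LP≡MD') ⟩
    dot (laplacian G P) f         ≡⟨ laplacian-selfAdjoint P f ⟩
    dot P (laplacian G f)         ≡⟨ dot-comm P (laplacian G f) ⟩
    dot (laplacian G f) P         ≡⟨ dot-congˡ P Lf≡mD ⟩
    dot (λ x → + m * D x) P       ≡⟨ dot-*ˡ (+ m) D P ⟩
    + m * dot D P                 ∎

  pairingIs-intro : ∀ {M : ℕ} {P P' D D' : Fin n → ℤ} {q} → 0 ℕ.< M →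
    (∀ x → laplacian G P x ≡ + M * D x) → (∀ x → laplacian G P' x ≡ + M * D' x) →
    (dot D P' /? M) ≡ℚ/ℤ q → PairingIs G D D' q
  pairingIs-intro {M} {P} {P'} {D} {D'} {q} 0<M LP≡MD LP'≡MD' value =
    (M , P , 0<M , LP≡MD) ,
    λ m f 0<m Lf≡mD → subst (_≡ℚ/ℤ q) (sym (/?-cong 0<m 0<M (cross-multiplied Lf≡mD))) value
    where
    cross-multiplied : ∀ {m f} → (∀ x → laplacian G f x ≡ + m * D x) → dot f D' * + M ≡ dot D P' * + m
    cross-multiplied {m} {f} Lf≡mD = begin
      dot f D' * + M    ≡⟨ ℤₚ.*-comm (dot f D') (+ M) ⟩
      + M * dot f D'    ≡⟨ pairing-via-preimage {m} {M} Lf≡mD LP'≡MD' ⟩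
      + m * dot D P'    ≡⟨ ℤₚ.*-comm (+ m) (dot D P') ⟩
      dot D P' * + m    ∎

edge⇒complete₂ : ∀ {n} (G : Graph n) → n ≡ 2 → ∀ {u v} → adj G u v ≡ true → Complete G
edge⇒complete₂ G refl {u} {v} uv = complete (edge₀₁ u v uv)
  where
  open Adjacency G using (edge⇒≢)
  edge₀₁ : ∀ u v → adj G u v ≡ true → adj G zero (suc zero) ≡ true
  edge₀₁ zero       zero       uv = contradiction refl (edge⇒≢ uv)
  edge₀₁ zero       (suc zero) uv = uv
  edge₀₁ (suc zero) zero       uv = trans (symm G zero (suc zero)) uv
  edge₀₁ (suc zero) (suc zero) uv = contradiction refl (edge⇒≢ uv)
  complete : adj G zero (suc zero) ≡ true → Complete G
  complete e zero       zero       x≢y = contradiction refl x≢y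
  complete e zero       (suc zero) _   = e
  complete e (suc zero) zero       _   = trans (symm G (suc zero) zero) e
  complete e (suc zero) (suc zero) x≢y = contradiction refl x≢y

Fin⇒0<n : ∀ {n} → Fin n → 0 ℕ.< n
Fin⇒0<n {suc _} _ = s≤s z≤n

0<2[n∸1] : ∀ {n} → 2 ℕ.≤ n → 0 ℕ.< 2 ℕ.* (n ℕ.∸ 1)
0<2[n∸1] {suc zero}    (s≤s ())
0<2[n∸1] {suc (suc n)} _ = s≤s z≤n

2[n∸1]<kn : ∀ {k n} → 2 ℕ.≤ k → 1 ℕ.≤ n → 2 ℕ.* (n ℕ.∸ 1) ℕ.< k ℕ.* n
2[n∸1]<kn {k} {suc n} 2≤k _ = ℕₚ.<-≤-trans (ℕₚ.*-monoʳ-< 2 (ℕₚ.n<1+n n)) (ℕₚ.*-monoˡ-≤ (suc n) 2≤k)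

pos-2[n∸1] : ∀ {n} → 1 ℕ.≤ n → + (2 ℕ.* (n ℕ.∸ 1)) ≡ + 2 * (+ n - 1ℤ)
pos-2[n∸1] {suc n} _ = ℤₚ.pos-* 2 n

-- With k = 1 the identity k(k − λ − 1) = μ(n − k − 1) reads −λ = μ(n − 2).
1-regular⇒order-2 : ∀ {l μ n} → μ ≢ 0 → 2 ℕ.≤ n →
  1ℤ * (1ℤ - + l - 1ℤ) ≡ + μ * (+ n - 1ℤ - 1ℤ) → n ≡ 2
1-regular⇒order-2 {n = suc zero} _ (s≤s ())
1-regular⇒order-2 {l} {μ} {suc (suc n)} μ≢0 _ identity = cong (λ m → suc (suc m)) n≡0
  where
  l+μn≡0 : l ℕ.+ μ ℕ.* n ≡ 0
  l+μn≡0 = ℤₚ.+-injective (begin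
    + (l ℕ.+ μ ℕ.* n)            ≡⟨ ℤₚ.pos-+ l (μ ℕ.* n) ⟩
    + l + + (μ ℕ.* n)            ≡⟨ cong (_+_ (+ l)) (ℤₚ.pos-* μ n) ⟩
    + l + + μ * + n              ≡⟨ cong (_+_ (+ l)) identity ⟨
    + l + 1ℤ * (1ℤ - + l - 1ℤ)   ≡⟨ cancel (+ l) ⟩
    0ℤ                           ∎)
    where
    cancel : ∀ a → a + 1ℤ * (1ℤ - a - 1ℤ) ≡ 0ℤ
    cancel = solve-∀
  n≡0 : n ≡ 0
  n≡0 = [ (λ μ≡0 → contradiction μ≡0 μ≢0) , id ]′ (ℕₚ.m*n≡0⇒m≡0∨n≡0 μ (ℕₚ.m+n≡0⇒n≡0 l l+μn≡0))

module StronglyRegular {n} {G : Graph n} {k l μ : ℕ} (srg : IsSRG G k l μ) where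
  open Adjacency G

  K Λ M N c : ℤ
  K = + k
  Λ = + l
  M = + μ
  N = + n
  c = K - Λ + M

  regular : ∀ x → deg G x ≡ k
  regular = proj₁ srg

  laplacian-regular : ∀ f x → laplacian G f x ≡ K * f x - A· f x
  laplacian-regular f x = trans (laplacian≡ f x) (cong (λ d → + d * f x - A· f x) (regular x))

  A·-const1-regular : ∀ x → A· (λ _ → 1ℤ) x ≡ K
  A·-const1-regular x = trans (A·-const1 x) (cong +_ (regular x))

  commonNbrs-srg : ∀ x y → + commonNbrs G x y ≡ (K - M) * δ y x + (Λ - M) * A x y + M
  commonNbrs-srg x y with x Finₚ.≟ y
  ... | yes refl = begin
    + commonNbrs G x x                          ≡⟨ cong +_ (trans (commonNbrs-diag x) (regular x)) ⟩
    K                                           ≡⟨ diagonal K Λ M ⟩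
    (K - M) * 1ℤ + (Λ - M) * 0ℤ + M             ≡⟨ cong₂ (λ d a → (K - M) * d + (Λ - M) * a + M) (δ-refl x) (A-diag x) ⟨
    (K - M) * δ x x + (Λ - M) * A x x + M       ∎
    where
    diagonal : ∀ k l μ → k ≡ (k - μ) * 1ℤ + (l - μ) * 0ℤ + μ
    diagonal = solve-∀
  ... | no x≢y with adj G x y in xy
  ...   | true = begin
    + commonNbrs G x y                          ≡⟨ cong +_ (proj₁ (proj₂ srg) x y x≢y xy) ⟩
    Λ                                           ≡⟨ adjacent K Λ M ⟩
    (K - M) * 0ℤ + (Λ - M) * 1ℤ + M             ≡⟨ cong (λ d → (K - M) * d + (Λ - M) * 1ℤ + M) (δ-≢ (≢-sym x≢y)) ⟨
    (K - M) * δ y x + (Λ - M) * 1ℤ + M          ∎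
    where
    adjacent : ∀ k l μ → l ≡ (k - μ) * 0ℤ + (l - μ) * 1ℤ + μ
    adjacent = solve-∀
  ...   | false = begin
    + commonNbrs G x y                          ≡⟨ cong +_ (proj₂ (proj₂ srg) x y x≢y xy) ⟩
    M                                           ≡⟨ nonadjacent K Λ M ⟩
    (K - M) * 0ℤ + (Λ - M) * 0ℤ + M             ≡⟨ cong (λ d → (K - M) * d + (Λ - M) * 0ℤ + M) (δ-≢ (≢-sym x≢y)) ⟨
    (K - M) * δ y x + (Λ - M) * 0ℤ + M          ∎
    where
    nonadjacent : ∀ k l μ → μ ≡ (k - μ) * 0ℤ + (l - μ) * 0ℤ + μ
    nonadjacent = solve-∀

  A·A·-srg : ∀ f x → A· (A· f) x ≡ (K - M) * f x + (Λ - M) * A· f x + M * sum f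
  A·A·-srg f x = begin
    A· (A· f) x                                                       ≡⟨ A·A·≡∑commonNbrs f x ⟩
    sum (λ y → + commonNbrs G x y * f y)                              ≡⟨ sum-cong-≗ expand ⟩
    sum (λ y → (K - M) * (f y * δ y x) + (Λ - M) * (A x y * f y) + M * f y)
      ≡⟨ ∑-distrib-+ (λ y → (K - M) * (f y * δ y x) + (Λ - M) * (A x y * f y)) (λ y → M * f y) ⟩
    sum (λ y → (K - M) * (f y * δ y x) + (Λ - M) * (A x y * f y)) + sum (λ y → M * f y)
      ≡⟨ cong (_+ sum (λ y → M * f y)) (∑-distrib-+ (λ y → (K - M) * (f y * δ y x)) (λ y → (Λ - M) * (A x y * f y))) ⟩
    sum (λ y → (K - M) * (f y * δ y x)) + sum (λ y → (Λ - M) * (A x y * f y)) + sum (λ y → M * f y)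
      ≡⟨ cong₂ _+_ (cong₂ _+_ (*-distribˡ-sum (K - M) (λ y → f y * δ y x))
                              (*-distribˡ-sum (Λ - M) (λ y → A x y * f y)))
                   (*-distribˡ-sum M f) ⟨
    (K - M) * sum (λ y → f y * δ y x) + (Λ - M) * A· f x + M * sum f
      ≡⟨ cong (λ s → (K - M) * s + (Λ - M) * A· f x + M * sum f) (∑-*δ f x) ⟩
    (K - M) * f x + (Λ - M) * A· f x + M * sum f                      ∎
    where
    expand : ∀ y → + commonNbrs G x y * f y ≡ (K - M) * (f y * δ y x) + (Λ - M) * (A x y * f y) + M * f y
    expand y = trans (cong (_* f y) (commonNbrs-srg x y)) (rearrange (K - M) (Λ - M) M (δ y x) (A x y) (f y))
      where
      rearrange : ∀ p q r d a b → (p * d + q * a + r) * b ≡ p * (b * d) + q * (a * b) + r * b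
      rearrange = solve-∀

  -- Evaluate A²𝟙 at x in two ways: as k² by regularity and via A·A·-srg.
  k[k-λ-1]≡μ[n-k-1] : Fin n → K * (K - Λ - 1ℤ) ≡ M * (N - K - 1ℤ)
  k[k-λ-1]≡μ[n-k-1] x = begin
    K * (K - Λ - 1ℤ)                                    ≡⟨ expand K Λ ⟩
    K * K - (Λ * K + K)                                 ≡⟨ cong (_- (Λ * K + K)) k²≡ ⟩
    (K - M) * 1ℤ + (Λ - M) * K + M * N - (Λ * K + K)    ≡⟨ collect K Λ M N ⟩
    M * (N - K - 1ℤ)                                    ∎
    where
    expand : ∀ k l → k * (k - l - 1ℤ) ≡ k * k - (l * k + k)
    expand = solve-∀
    collect : ∀ k l μ n → (k - μ) * 1ℤ + (l - μ) * k + μ * n - (l * k + k) ≡ μ * (n - k - 1ℤ)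
    collect = solve-∀
    𝟙 : Fin n → ℤ
    𝟙 _ = 1ℤ
    k²≡ : K * K ≡ (K - M) * 1ℤ + (Λ - M) * K + M * N
    k²≡ = begin
      K * K                                      ≡⟨ cong (_* K) (A·-const1-regular x) ⟨
      A· 𝟙 x * K                                 ≡⟨ *-distribʳ-sum K (λ y → A x y * 1ℤ) ⟩
      sum (λ y → A x y * 1ℤ * K)                 ≡⟨ sum-cong-≗ (λ y → trans (ℤₚ.*-assoc (A x y) 1ℤ K)
                                                      (cong (A x y *_) (trans (ℤₚ.*-identityˡ K) (sym (A·-const1-regular y))))) ⟩
      A· (A· 𝟙) x                                ≡⟨ A·A·-srg 𝟙 x ⟩
      (K - M) * 1ℤ + (Λ - M) * A· 𝟙 x + M * sum 𝟙
        ≡⟨ cong₂ (λ a s → (K - M) * 1ℤ + (Λ - M) * a + M * s) (A·-const1-regular x) (sum-const-1 n) ⟩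
      (K - M) * 1ℤ + (Λ - M) * K + M * N         ∎

  preimage : (Fin n → ℤ) → Fin n → ℤ
  preimage f x = c * f x + A· f x

  laplacian-preimage : ∀ f → sum f ≡ 0ℤ → ∀ x → laplacian G (preimage f) x ≡ + (μ ℕ.* n) * f x
  laplacian-preimage f Σf≡0 x = begin
    laplacian G (preimage f) x                                         ≡⟨ laplacian-regular (preimage f) x ⟩
    K * preimage f x - A· (preimage f) x                               ≡⟨ cong (_-_ (K * preimage f x)) (A·-linear c f (A· f) x) ⟩
    K * preimage f x - (c * A· f x + A· (A· f) x)
      ≡⟨ cong (λ s → K * preimage f x - (c * A· f x + s)) (A·A·-srg f x) ⟩
    K * preimage f x - (c * A· f x + ((K - M) * f x + (Λ - M) * A· f x + M * sum f))
      ≡⟨ cong (λ s → K * preimage f x - (c * A· f x + ((K - M) * f x + (Λ - M) * A· f x + M * s))) Σf≡0 ⟩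
    K * preimage f x - (c * A· f x + ((K - M) * f x + (Λ - M) * A· f x + M * 0ℤ))
      ≡⟨ collect K Λ M (f x) (A· f x) ⟩
    (K * (K - Λ - 1ℤ) + M * K + M) * f x                              ≡⟨ cong (λ s → (s + M * K + M) * f x) (k[k-λ-1]≡μ[n-k-1] x) ⟩
    (M * (N - K - 1ℤ) + M * K + M) * f x                              ≡⟨ simplify K M N (f x) ⟩
    M * N * f x                                                        ≡⟨ cong (_* f x) (ℤₚ.pos-* μ n) ⟨
    + (μ ℕ.* n) * f x                                                  ∎
    where
    collect : ∀ k l μ d a →
      k * ((k - l + μ) * d + a) - ((k - l + μ) * a + ((k - μ) * d + (l - μ) * a + μ * 0ℤ))
        ≡ (k * (k - l - 1ℤ) + μ * k + μ) * d
    collect = solve-∀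
    simplify : ∀ k μ n d → (μ * (n - k - 1ℤ) + μ * k + μ) * d ≡ μ * n * d
    simplify = solve-∀

  preimage-eDiff : ∀ u v w → preimage (eDiff u v) w ≡ c * (δ w u - δ w v) + (A w u - A w v)
  preimage-eDiff u v w = cong₂ _+_ (cong (c *_) (eDiff≡δ-δ u v w)) (∑-*eDiff (A w) u v)

  preimage-eDiff-source : ∀ {u v} → adj G u v ≡ true → preimage (eDiff u v) u ≡ c - 1ℤ
  preimage-eDiff-source {u} {v} uv = begin
    preimage (eDiff u v) u                  ≡⟨ preimage-eDiff u v u ⟩
    c * (δ u u - δ u v) + (A u u - A u v)   ≡⟨ cong₂ (λ d a → c * d + a) (cong₂ _-_ (δ-refl u) (δ-≢ (edge⇒≢ uv)))
                                                                       (cong₂ _-_ (A-diag u) (A-edge uv)) ⟩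
    c * (1ℤ - 0ℤ) + (0ℤ - 1ℤ)               ≡⟨ evaluate c ⟩
    c - 1ℤ                                  ∎
    where
    evaluate : ∀ c → c * (1ℤ - 0ℤ) + (0ℤ - 1ℤ) ≡ c - 1ℤ
    evaluate = solve-∀

  preimage-eDiff-target : ∀ {u v} → adj G u v ≡ true → preimage (eDiff u v) v ≡ 1ℤ - c
  preimage-eDiff-target {u} {v} uv = begin
    preimage (eDiff u v) v                  ≡⟨ preimage-eDiff u v v ⟩
    c * (δ v u - δ v v) + (A v u - A v v)   ≡⟨ cong₂ (λ d a → c * d + a) (cong₂ _-_ (δ-≢ (≢-sym (edge⇒≢ uv))) (δ-refl v))
                                                                       (cong₂ _-_ (A-edge (trans (symm G v u) uv)) (A-diag v)) ⟩
    c * (0ℤ - 1ℤ) + (1ℤ - 0ℤ)               ≡⟨ evaluate c ⟩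
    1ℤ - c                                  ∎
    where
    evaluate : ∀ c → c * (0ℤ - 1ℤ) + (1ℤ - 0ℤ) ≡ 1ℤ - c
    evaluate = solve-∀

  preimage-eDiff-away : ∀ {x y w} → x ≢ w → y ≢ w → preimage (eDiff x y) w ≡ A x w - A y w
  preimage-eDiff-away {x} {y} {w} x≢w y≢w = begin
    preimage (eDiff x y) w                  ≡⟨ preimage-eDiff x y w ⟩
    c * (δ w x - δ w y) + (A w x - A w y)   ≡⟨ cong₂ (λ d a → c * d + a) (cong₂ _-_ (δ-≢ (≢-sym x≢w)) (δ-≢ (≢-sym y≢w)))
                                                                       (cong₂ _-_ (A-sym w x) (A-sym w y)) ⟩
    c * (0ℤ - 0ℤ) + (A x w - A y w)         ≡⟨ vanish c (A x w - A y w) ⟩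
    A x w - A y w                           ∎
    where
    vanish : ∀ c a → c * (0ℤ - 0ℤ) + a ≡ a
    vanish = solve-∀

  dot-eDiff-preimage-edge : ∀ {u v} → adj G u v ≡ true →
    dot (eDiff u v) (preimage (eDiff u v)) ≡ + 2 * (c - 1ℤ)
  dot-eDiff-preimage-edge {u} {v} uv = begin
    dot (eDiff u v) (preimage (eDiff u v))            ≡⟨ dot-eDiffˡ u v (preimage (eDiff u v)) ⟩
    preimage (eDiff u v) u - preimage (eDiff u v) v   ≡⟨ cong₂ _-_ (preimage-eDiff-source uv) (preimage-eDiff-target uv) ⟩
    (c - 1ℤ) - (1ℤ - c)                               ≡⟨ double c ⟩
    + 2 * (c - 1ℤ)                                    ∎
    where
    double : ∀ c → (c - 1ℤ) - (1ℤ - c) ≡ + 2 * (c - 1ℤ)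
    double = solve-∀

  dot-eDiff-preimage-disjoint : ∀ {u v x y} → x ≢ u → x ≢ v → y ≢ u → y ≢ v →
    A x u - A y u ≡ A x v - A y v → dot (eDiff u v) (preimage (eDiff x y)) ≡ 0ℤ
  dot-eDiff-preimage-disjoint {u} {v} {x} {y} x≢u x≢v y≢u y≢v balanced = begin
    dot (eDiff u v) (preimage (eDiff x y))            ≡⟨ dot-eDiffˡ u v (preimage (eDiff x y)) ⟩
    preimage (eDiff x y) u - preimage (eDiff x y) v   ≡⟨ cong₂ _-_ (preimage-eDiff-away x≢u y≢u) (preimage-eDiff-away x≢v y≢v) ⟩
    (A x u - A y u) - (A x v - A y v)                 ≡⟨ cong (_- (A x v - A y v)) balanced ⟩
    (A x v - A y v) - (A x v - A y v)                 ≡⟨ ℤₚ.+-inverseʳ (A x v - A y v) ⟩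
    0ℤ                                                ∎

  0<μn : μ ≢ 0 → Fin n → 0 ℕ.< μ ℕ.* n
  0<μn μ≢0 x = ℕₚ.*-mono-< (ℕₚ.n≢0⇒n>0 μ≢0) (Fin⇒0<n x)

  1≤k : ∀ {u v} → adj G u v ≡ true → 1 ℕ.≤ k
  1≤k {u} uv = subst (1 ℕ.≤_) (regular u) (edge⇒1≤deg uv)

  pairing-edge : μ ≢ 0 → ∀ {u v} → adj G u v ≡ true →
    PairingIs G (eDiff u v) (eDiff u v) ((+ (2 ℕ.* (n ℕ.∸ 1))) /? (k ℕ.* n))
  pairing-edge μ≢0 {u} {v} uv = pairingIs-intro (0<μn μ≢0 u) Lp≡μnD Lp≡μnD (≡⇒≡ℚ/ℤ (begin
    dot (eDiff u v) (preimage (eDiff u v)) /? (μ ℕ.* n)  ≡⟨ cong (_/? (μ ℕ.* n)) (dot-eDiff-preimage-edge uv) ⟩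
    (+ 2 * (c - 1ℤ)) /? (μ ℕ.* n)                        ≡⟨ /?-cong (0<μn μ≢0 u) 0<kn cross-multiplied ⟩
    (+ (2 ℕ.* (n ℕ.∸ 1))) /? (k ℕ.* n)                   ∎))
    where
    Lp≡μnD : ∀ w → laplacian G (preimage (eDiff u v)) w ≡ + (μ ℕ.* n) * eDiff u v w
    Lp≡μnD = laplacian-preimage (eDiff u v) (sum-eDiff u v)
    0<kn : 0 ℕ.< k ℕ.* n
    0<kn = ℕₚ.*-mono-< (1≤k uv) (Fin⇒0<n u)
    cross-multiplied : + 2 * (c - 1ℤ) * + (k ℕ.* n) ≡ + (2 ℕ.* (n ℕ.∸ 1)) * + (μ ℕ.* n)
    cross-multiplied = begin
      + 2 * (c - 1ℤ) * + (k ℕ.* n)            ≡⟨ cong (_*_ (+ 2 * (c - 1ℤ))) (ℤₚ.pos-* k n) ⟩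
      + 2 * (c - 1ℤ) * (K * N)                ≡⟨ expand K Λ M N ⟩
      + 2 * N * (K * (K - Λ - 1ℤ) + M * K)    ≡⟨ cong (λ s → + 2 * N * (s + M * K)) (k[k-λ-1]≡μ[n-k-1] u) ⟩
      + 2 * N * (M * (N - K - 1ℤ) + M * K)    ≡⟨ collect K M N ⟩
      + 2 * (N - 1ℤ) * (M * N)                ≡⟨ cong₂ _*_ (pos-2[n∸1] (Fin⇒0<n u)) (ℤₚ.pos-* μ n) ⟨
      + (2 ℕ.* (n ℕ.∸ 1)) * + (μ ℕ.* n)       ∎
      where
      expand : ∀ k l μ n → + 2 * (k - l + μ - 1ℤ) * (k * n) ≡ + 2 * n * (k * (k - l - 1ℤ) + μ * k)
      expand = solve-∀
      collect : ∀ k μ n → + 2 * n * (μ * (n - k - 1ℤ) + μ * k) ≡ + 2 * (n - 1ℤ) * (μ * n)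
      collect = solve-∀

  pairing-disjoint : μ ≢ 0 → ∀ {u v x y} → x ≢ u → x ≢ v → y ≢ u → y ≢ v →
    A x u - A y u ≡ A x v - A y v → PairingIs G (eDiff u v) (eDiff x y) 0ℚ
  pairing-disjoint μ≢0 {u} {v} {x} {y} x≢u x≢v y≢u y≢v balanced =
    pairingIs-intro {q = 0ℚ} (0<μn μ≢0 u) (laplacian-preimage (eDiff u v) (sum-eDiff u v))
                                 (laplacian-preimage (eDiff x y) (sum-eDiff x y))
      (≡⇒≡ℚ/ℤ (trans (cong (_/? (μ ℕ.* n)) (dot-eDiff-preimage-disjoint x≢u x≢v y≢u y≢v balanced))
                     (0/?≡0 (0<μn μ≢0 u))))

  μ≡0⇒reach⇒≡⊎adj : μ ≡ 0 → ∀ {x z} → Reach G x z → x ≡ z ⊎ adj G x z ≡ true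
  μ≡0⇒reach⇒≡⊎adj μ≡0 here = inj₁ refl
  μ≡0⇒reach⇒≡⊎adj μ≡0 (step {x} {y} {z} xy walk) with μ≡0⇒reach⇒≡⊎adj μ≡0 walk
  ... | inj₁ refl = inj₂ xy
  ... | inj₂ yz with x Finₚ.≟ z | adj G x z in xz
  ...   | yes x≡z | _     = inj₁ x≡z
  ...   | no  _   | true  = inj₂ refl
  ...   | no  x≢z | false = contradiction common-neighbour (λ ())
    where
    common-neighbour : 1 ℕ.≤ 0
    common-neighbour = subst (1 ℕ.≤_) (trans (proj₂ (proj₂ srg) x z x≢z xz) μ≡0)
                             (commonNbr⇒1≤commonNbrs xy (trans (symm G z y) yz))

  connected⇒μ≢0 : Connected G → ¬ Complete G → μ ≢ 0
  connected⇒μ≢0 connected ¬complete μ≡0 =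
    ¬complete (λ x y x≢y → [ (λ x≡y → contradiction x≡y x≢y) , id ]′ (μ≡0⇒reach⇒≡⊎adj μ≡0 (connected x y)))

  2≤k : μ ≢ 0 → ¬ Complete G → ∀ {u v} → adj G u v ≡ true → 2 ℕ.≤ k
  2≤k μ≢0 ¬complete {u} uv with k ℕ.≟ 1
  ... | no  k≢1 = ℕₚ.≤∧≢⇒< (1≤k uv) (≢-sym k≢1)
  ... | yes k≡1 = contradiction (edge⇒complete₂ G n≡2 uv) ¬complete
    where
    n≡2 : n ≡ 2
    n≡2 = 1-regular⇒order-2 {l} μ≢0 (distinct⇒2≤n (edge⇒≢ uv))
            (subst (λ k → + k * (+ k - Λ - 1ℤ) ≡ M * (N - + k - 1ℤ)) k≡1 (k[k-λ-1]≡μ[n-k-1] u))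

  pairing-edge-nonintegral : μ ≢ 0 → ¬ Complete G → ∀ {u v} → adj G u v ≡ true →
    ¬ IsInt ((+ (2 ℕ.* (n ℕ.∸ 1))) /? (k ℕ.* n))
  pairing-edge-nonintegral μ≢0 ¬complete {u} uv =
    ¬IsInt-/? (0<2[n∸1] (distinct⇒2≤n (edge⇒≢ uv))) (2[n∸1]<kn (2≤k μ≢0 ¬complete uv) (Fin⇒0<n u))

proposition4p3 :
    (n k l m : ℕ) (G : Graph n) →
    IsSRG G k l m → Connected G → ¬ Complete G → ¬ CompleteBipartite G →
    (∀ (u v : Fin n) → adj G u v ≡ true →
      PairingIs G (eDiff u v) (eDiff u v) ((+ (2 ℕ.* (n ℕ.∸ 1))) /? (k ℕ.* n))
      × ¬ IsInt ((+ (2 ℕ.* (n ℕ.∸ 1))) /? (k ℕ.* n)))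
    ×
    (∀ (u v x y : Fin n) → adj G u v ≡ true → adj G x y ≡ true →
      x ≢ u → x ≢ v → y ≢ u → y ≢ v →
      ((adj G x u ≡ adj G y u × adj G x v ≡ adj G y v)
       ⊎ (adj G x u ≡ true × adj G x v ≡ true × adj G y u ≡ false × adj G y v ≡ false)
       ⊎ (adj G x u ≡ false × adj G x v ≡ false × adj G y u ≡ true × adj G y v ≡ true)) →
      PairingIs G (eDiff u v) (eDiff x y) 0ℚ)
proposition4p3 n k l m G srg connected ¬complete _ =
  (λ u v uv → pairing-edge μ≢0 uv , pairing-edge-nonintegral μ≢0 ¬complete uv) ,
  (λ u v x y _ _ x≢u x≢v y≢u y≢v adjacency → pairing-disjoint μ≢0 x≢u x≢v y≢u y≢v (sameDifference adjacency))
  where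
  open StronglyRegular srg
  μ≢0 : m ≢ 0
  μ≢0 = connected⇒μ≢0 connected ¬complete
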